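{- Let $p,q,n$ be positive integers with $p+q=n\geq 4$ and $p\leq q$. Then: (i) $\partial(R(K_n))=\frac{n(n-1)}{2}-n+3$; (ii) $\partial(R(W_n))=2n-3$; (iii) $\partial(R(K_{p,q}))=q(p+1)-p$.
   Context: For a graph $G$, $R(G)$ is the graph obtained from $G$ by adding, for each edge $e=xy\in E(G)$, a new vertex $v_e$ adjacent exactly to $x$ and $y$. For a graph $H$ and $S\subseteq V(H)$, $B_H(S)$ is the set of vertices not in $S$ adjacent to some vertex of $S$, $\partial_H(S)=|B_H(S)|-|S|$, and $\partial(H)=\max_{S\subseteq V(H)}\partial_H(S)$. $K_n$ is the complete graph on $n$ vertices, $K_{p,q}$ the complete bipartite graph with parts of sizes $p$ and $q$, and $W_n$ (for $n\geq 4$) is the wheel of order $n$: a cycle $C_{n-1}$ plus one apex vertex adjacent to every vertex of the cycle. -}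

module Defs where

open import Data.Bool using (Bool; true; false; _∧_; _∨_; not; if_then_else_; _xor_)
open import Data.Nat using (ℕ; zero; suc; _+_; _*_; _∸_; _/_; _≡ᵇ_; _<ᵇ_)
open import Data.Fin using (Fin; toℕ)
open import Data.Bool.ListAction using (any)
open import Data.List using (List; []; _∷_; filterᵇ; length; allFin; concatMap; map; _++_)
open import Data.Product using (_×_; _,_; proj₁; proj₂; ∃)
open import Data.Sum using (_⊎_; inj₁; inj₂)
open import Data.Integer as ℤ using (ℤ; +_; _-_; _≤_)
open import Relation.Binary.PropositionalEquality using (_≡_)

-- (Only symmetric, irreflexive adjacency functions are used below.)
Graph : ℕ → Set
Graph n = Fin n → Fin n → Bool

adj : ∀ {n} → Graph n → Fin n → Fin n → Bool
adj G = G

-- Finite graphs whose vertex set is given by an explicit list of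
-- (distinct) elements of some type V.  Subsets S ⊆ V(H) are Boolean
-- predicates; only the values on the listed vertices matter.

record LGraph : Set₁ where
  field
    V     : Set
    verts : List V
    ladj  : V → V → Bool

open LGraph public

card : (H : LGraph) → (V H → Bool) → ℕ
card H S = length (filterᵇ S (verts H))

B : (H : LGraph) → (V H → Bool) → List (V H)
B H S = filterᵇ (λ v → not (S v) ∧ any (λ u → S u ∧ ladj H u v) (verts H)) (verts H)

∂ₛ : (H : LGraph) → (V H → Bool) → ℤ
∂ₛ H S = (+ length (B H S)) - (+ card H S)

∂Is : LGraph → ℤ → Set
∂Is H k = (∃ λ (S : V H → Bool) → ∂ₛ H S ≡ k) × (∀ (S : V H → Bool) → ∂ₛ H S ℤ.≤ k)

_==_ : ∀ {n} → Fin n → Fin n → Bool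
i == j = toℕ i ≡ᵇ toℕ j

edges : ∀ {n} → Graph n → List (Fin n × Fin n)
edges {n} G =
  concatMap (λ i → map (λ j → (i , j))
    (filterᵇ (λ j → (toℕ i <ᵇ toℕ j) ∧ adj G i j) (allFin n))) (allFin n)

-- R(G): original vertices inj₁ i, and a new vertex inj₂ e for each edge e
R : ∀ {n} → Graph n → LGraph
R {n} G = record
  { V     = Fin n ⊎ (Fin n × Fin n)
  ; verts = map inj₁ (allFin n) ++ map inj₂ (edges G)
  ; ladj  = a
  }
  where
  a : Fin n ⊎ (Fin n × Fin n) → Fin n ⊎ (Fin n × Fin n) → Bool
  a (inj₁ i)       (inj₁ j)       = adj G i j
  a (inj₁ i)       (inj₂ (x , y)) = (i == x) ∨ (i == y)
  a (inj₂ (x , y)) (inj₁ j)       = (j == x) ∨ (j == y)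
  a (inj₂ _)       (inj₂ _)       = false

K : (n : ℕ) → Graph n
K n i j = not (i == j)

Kbip : (p q : ℕ) → Graph (p + q)
Kbip p q i j = (toℕ i <ᵇ p) xor (toℕ j <ᵇ p)

-- wheel W_n: apex 0, cycle 1 - 2 - ... - (n-1) - 1
W : (n : ℕ) → Graph n
W n i j = w (toℕ i) (toℕ j)
  where
  z : ℕ → Bool
  z a = a ≡ᵇ 0
  cyc : ℕ → ℕ → Bool
  cyc a b = (suc a ≡ᵇ b) ∨ (suc b ≡ᵇ a)
          ∨ ((a ≡ᵇ 1) ∧ (b ≡ᵇ (n ∸ 1))) ∨ ((b ≡ᵇ 1) ∧ (a ≡ᵇ (n ∸ 1)))
  w : ℕ → ℕ → Bool
  w a b = (z a ∧ not (z b)) ∨ (z b ∧ not (z a)) ∨ (not (z a) ∧ not (z b) ∧ cyc a b)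

-- For S ⊆ V(R(G)) put α = S ∩ V(G). A boundary vertex of S is either a vertex of G
-- outside α or an edge vertex v_e with e meeting α, and |S| ≥ |α|; hence
-- ∂(S) ≤ |V(G) ∖ α| + e(α) − |α|, where e(α) is the number of edges of G meeting α.
-- Conversely, if S = α ⊆ V(G) contains a vertex c, then B(S) contains every v_e with e
-- meeting α and every neighbour of c outside α. So ∂(R(G)) is pinned down by an upper
-- bound over all α and one well-chosen α; what remains is counting. For K_n,
-- e(α) = C(n,2) − C(k,2) with k = |V ∖ α|, and 2k − C(k,2) ≤ 3 (attained by omitting two
-- vertices). For K_{p,q}, e(α) = pq − k₁k₂ (attained by the smaller side). For W_n, e(α)
-- is at most the spokes plus the rim edges meeting α, and the rim edges are bounded by
-- summing local inequalities around the rim cycle (attained by the hub alone).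

module Submission where

open import Defs
open import Data.Nat using (ℕ; _+_; _*_; _∸_; _/_; _≤_)
open import Data.Integer using (ℤ; +_; _-_) renaming (_+_ to _⊕_)
open import Data.Product using (_×_)
open import Relation.Binary.PropositionalEquality using (_≡_)

open import Data.Bool using (Bool; true; false; _∧_; _∨_; not; T; _xor_)
open import Data.Bool.ListAction using (any)
open import Data.Bool.Properties using (T-∧; T-∨; ∧-assoc; ∨-comm; ∨-zeroʳ; ∨-identityʳ; xor-identityʳ)
open import Data.Empty using (⊥-elim)
open import Data.Fin using (Fin; toℕ)
import Data.Fin as Fin
open import Data.Integer using (_⊖_)
import Data.Integer as ℤ using (_≤_)
open import Data.Integer.Properties using ([+m]-[+n]≡m⊖n; +-cancelˡ-⊖; ⊖-monoˡ-≤; pos-+)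
import Data.Integer.Properties as ℤ using (≤-antisym; module ≤-Reasoning)
import Data.Integer.Tactic.RingSolver as ℤ-Solver
open import Data.List using (List; []; _∷_; _++_; length; filterᵇ; tabulate; allFin; concatMap; map)
open import Data.List.Membership.Propositional using (_∈_; lose)
open import Data.List.Membership.Propositional.Properties using (∈-allFin; ∈-map⁺; ∈-++⁺ˡ)
open import Data.List.Relation.Unary.Any using (satisfied)
open import Data.List.Relation.Unary.Any.Properties using (any⁺; any⁻)
open import Data.Nat using (zero; suc; _<_; z≤n; s≤s; _<ᵇ_; _≡ᵇ_)
open import Data.Nat.DivMod using (m*n/n≡m)
open import Data.Nat.ListAction using (sum)
open import Data.Nat.Properties
open import Data.Nat.Tactic.RingSolver using (solve-∀)
open import Algebra.Properties.CommutativeSemigroup +-commutativeSemigroup using ()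
  renaming (interchange to +-interchange; xy∙z≈xz∙y to +-right-comm)
open import Data.Product using (_,_; proj₁; proj₂)
open import Data.Sum using (_⊎_; inj₁; inj₂)
open import Function using (_∘_; Equivalence)
open import Relation.Binary.PropositionalEquality
  using (_≢_; ≢-sym; refl; sym; trans; cong; cong₂; subst; subst₂; module ≡-Reasoning)

open Equivalence using (to; from)

bool→ℕ : Bool → ℕ
bool→ℕ true  = 1
bool→ℕ false = 0

bool→ℕ≤1 : ∀ x → bool→ℕ x ≤ 1
bool→ℕ≤1 true  = ≤-refl
bool→ℕ≤1 false = z≤n

bool→ℕ-mono : ∀ {x y} → (T x → T y) → bool→ℕ x ≤ bool→ℕ y
bool→ℕ-mono {false}         _  = z≤n
bool→ℕ-mono {true}  {true}  _  = ≤-refl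
bool→ℕ-mono {true}  {false} x⇒y = ⊥-elim (x⇒y _)

bool→ℕ-∨ : ∀ x y → bool→ℕ (x ∨ y) ≤ bool→ℕ x + bool→ℕ y
bool→ℕ-∨ true  _ = s≤s z≤n
bool→ℕ-∨ false _ = ≤-refl

bool→ℕ-∨-+-not : ∀ x y → bool→ℕ (x ∨ y) + bool→ℕ (not y) ≤ 1 + bool→ℕ x
bool→ℕ-∨-+-not true  true  = s≤s z≤n
bool→ℕ-∨-+-not true  false = ≤-refl
bool→ℕ-∨-+-not false true  = ≤-refl
bool→ℕ-∨-+-not false false = ≤-refl

<⇒<ᵇ≡true : ∀ {m n} → m < n → (m <ᵇ n) ≡ true
<⇒<ᵇ≡true {zero}  {suc n} _         = refl
<⇒<ᵇ≡true {suc m} {suc n} (s≤s m<n) = <⇒<ᵇ≡true m<n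

≤⇒<ᵇ≡false : ∀ {m n} → n ≤ m → (m <ᵇ n) ≡ false
≤⇒<ᵇ≡false {m}     {zero}  _         = refl
≤⇒<ᵇ≡false {suc m} {suc n} (s≤s n≤m) = ≤⇒<ᵇ≡false n≤m

≢⇒≡ᵇ≡false : ∀ m n → m ≢ n → (m ≡ᵇ n) ≡ false
≢⇒≡ᵇ≡false m n m≢n with m ≡ᵇ n in eq
... | true  = ⊥-elim (m≢n (≡ᵇ⇒≡ m n (subst T (sym eq) _)))
... | false = refl

sum< : ℕ → (ℕ → ℕ) → ℕ
sum< zero    F = 0
sum< (suc n) F = F 0 + sum< n (λ i → F (suc i))

sum<-cong : ∀ n {F G : ℕ → ℕ} → (∀ i → i < n → F i ≡ G i) → sum< n F ≡ sum< n G
sum<-cong zero    _   = refl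
sum<-cong (suc n) F≡G = cong₂ _+_ (F≡G 0 (s≤s z≤n)) (sum<-cong n (λ i i<n → F≡G (suc i) (s≤s i<n)))

sum<-mono : ∀ n {F G : ℕ → ℕ} → (∀ i → i < n → F i ≤ G i) → sum< n F ≤ sum< n G
sum<-mono zero    _   = z≤n
sum<-mono (suc n) F≤G = +-mono-≤ (F≤G 0 (s≤s z≤n)) (sum<-mono n (λ i i<n → F≤G (suc i) (s≤s i<n)))

sum<-+ : ∀ n (F G : ℕ → ℕ) → sum< n (λ i → F i + G i) ≡ sum< n F + sum< n G
sum<-+ zero    F G = refl
sum<-+ (suc n) F G = begin
    (F 0 + G 0) + sum< n (λ i → F (suc i) + G (suc i))
  ≡⟨ cong (_+_ (F 0 + G 0)) (sum<-+ n (F ∘ suc) (G ∘ suc)) ⟩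
    (F 0 + G 0) + (ΣF + ΣG)
  ≡⟨ +-interchange (F 0) (G 0) ΣF ΣG ⟩
    (F 0 + ΣF) + (G 0 + ΣG) ∎
  where
  open ≡-Reasoning
  ΣF = sum< n (F ∘ suc)
  ΣG = sum< n (G ∘ suc)

sum<-suc : ∀ n (F : ℕ → ℕ) → sum< (suc n) F ≡ sum< n F + F n
sum<-suc zero    F = +-comm (F 0) 0
sum<-suc (suc n) F = trans (cong (_+_ (F 0)) (sum<-suc n (F ∘ suc))) (sym (+-assoc (F 0) _ _))

sum<-+-range : ∀ p t (F : ℕ → ℕ) → sum< (p + t) F ≡ sum< p F + sum< t (λ i → F (p + i))
sum<-+-range zero    t F = refl
sum<-+-range (suc p) t F = trans (cong (_+_ (F 0)) (sum<-+-range p t (F ∘ suc))) (sym (+-assoc (F 0) _ _))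

count< : ℕ → (ℕ → Bool) → ℕ
count< n f = sum< n (λ i → bool→ℕ (f i))

count<-cong : ∀ n {f g : ℕ → Bool} → (∀ i → i < n → f i ≡ g i) → count< n f ≡ count< n g
count<-cong n f≡g = sum<-cong n (λ i i<n → cong bool→ℕ (f≡g i i<n))

count<-true : ∀ n → count< n (λ _ → true) ≡ n
count<-true zero    = refl
count<-true (suc n) = cong suc (count<-true n)

count<-false : ∀ n → count< n (λ _ → false) ≡ 0
count<-false zero    = refl
count<-false (suc n) = count<-false n

count<-+-count<-not : ∀ n f → count< n f + count< n (λ i → not (f i)) ≡ n
count<-+-count<-not zero    f = refl
count<-+-count<-not (suc n) f with f 0 | count<-+-count<-not n (f ∘ suc)
... | true  | eq = cong suc eq
... | false | eq = trans (+-suc _ _) (cong suc eq)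

count<-≡ᵇ : ∀ n c (f : ℕ → Bool) → count< n (λ i → (i ≡ᵇ c) ∧ f i) ≤ bool→ℕ (f c)
count<-≡ᵇ zero    c       f = z≤n
count<-≡ᵇ (suc n) zero    f = ≤-reflexive (trans (cong (_+_ (bool→ℕ (f 0))) (count<-false n)) (+-identityʳ _))
count<-≡ᵇ (suc n) (suc c) f = count<-≡ᵇ n c (f ∘ suc)

count<-suc : ∀ n f → count< (suc n) f ≡ count< n f + bool→ℕ (f n)
count<-suc n f = sum<-suc n (λ i → bool→ℕ (f i))

count<-+-range : ∀ p t f → count< (p + t) f ≡ count< p f + count< t (λ i → f (p + i))
count<-+-range p t f = sum<-+-range p t (λ i → bool→ℕ (f i))

count<-<ᵇ-∧ : ∀ p t f → count< (p + t) (λ i → (i <ᵇ p) ∧ f i) ≡ count< p f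
count<-<ᵇ-∧ zero    t f = count<-false t
count<-<ᵇ-∧ (suc p) t f = cong (_+_ (bool→ℕ (f 0))) (count<-<ᵇ-∧ p t (f ∘ suc))

count<-∨-true : ∀ n (f : ℕ → Bool) → count< n (λ i → f i ∨ true) ≡ n
count<-∨-true n f = trans (count<-cong n {λ i → f i ∨ true} (λ i _ → ∨-zeroʳ (f i))) (count<-true n)

count<-∨-false : ∀ n (f : ℕ → Bool) → count< n (λ i → f i ∨ false) ≡ count< n f
count<-∨-false n f = count<-cong n {λ i → f i ∨ false} (λ i _ → ∨-identityʳ (f i))

-- Pairs a < b < n, counted row by row as `edges` lists them.
countPairs< : ℕ → (ℕ → ℕ → Bool) → ℕ
countPairs< n F = sum< n (λ a → count< n (λ b → (a <ᵇ b) ∧ F a b))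

countPairs<-suc : ∀ n F → countPairs< (suc n) F ≡ countPairs< n F + count< n (λ a → F a n)
countPairs<-suc n F = begin
    sum< (suc n) (λ a → count< (suc n) (row a))
  ≡⟨ sum<-cong (suc n) (λ a _ → count<-suc n (row a)) ⟩
    sum< (suc n) (λ a → count< n (row a) + bool→ℕ (row a n))
  ≡⟨ sum<-+ (suc n) (λ a → count< n (row a)) (λ a → bool→ℕ (row a n)) ⟩
    sum< (suc n) (λ a → count< n (row a)) + count< (suc n) (λ a → row a n)
  ≡⟨ cong₂ _+_ (sum<-suc n (λ a → count< n (row a))) (count<-suc n (λ a → row a n)) ⟩
    (countPairs< n F + count< n (row n)) + (count< n (λ a → row a n) + bool→ℕ (row n n))
  ≡⟨ cong₂ _+_ (cong (_+_ (countPairs< n F)) row-n-empty)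
               (cong₂ _+_ column-n (cong (λ t → bool→ℕ (t ∧ F n n)) (≤⇒<ᵇ≡false {n} ≤-refl))) ⟩
    (countPairs< n F + 0) + (count< n (λ a → F a n) + 0)
  ≡⟨ cong₂ _+_ (+-identityʳ (countPairs< n F)) (+-identityʳ (count< n (λ a → F a n))) ⟩
    countPairs< n F + count< n (λ a → F a n) ∎
  where
  open ≡-Reasoning
  row : ℕ → ℕ → Bool
  row a b = (a <ᵇ b) ∧ F a b
  row-n-empty : count< n (row n) ≡ 0
  row-n-empty = trans (count<-cong n (λ b b<n → cong (_∧ F n b) (≤⇒<ᵇ≡false (<⇒≤ b<n)))) (count<-false n)
  column-n : count< n (λ a → row a n) ≡ count< n (λ a → F a n)
  column-n = count<-cong n (λ a a<n → cong (_∧ F a n) (<⇒<ᵇ≡true a<n))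

countPairs<-columns : ∀ n F → countPairs< n F ≡ sum< n (λ b → count< b (λ a → F a b))
countPairs<-columns zero    F = refl
countPairs<-columns (suc n) F = begin
    countPairs< (suc n) F
  ≡⟨ countPairs<-suc n F ⟩
    countPairs< n F + count< n (λ a → F a n)
  ≡⟨ cong (_+ count< n (λ a → F a n)) (countPairs<-columns n F) ⟩
    sum< n (λ b → count< b (λ a → F a b)) + count< n (λ a → F a n)
  ≡⟨ sum<-suc n (λ b → count< b (λ a → F a b)) ⟨
    sum< (suc n) (λ b → count< b (λ a → F a b)) ∎
  where open ≡-Reasoning

edgesMeeting : ℕ → (ℕ → ℕ → Bool) → (ℕ → Bool) → ℕ
edgesMeeting n g α = countPairs< n (λ a b → g a b ∧ (α a ∨ α b))

cycleSum : ℕ → (ℕ → ℕ → ℕ) → ℕ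
cycleSum l F = sum< l (λ i → F i (suc i)) + F l 0

cycleSum-mono : ∀ l {F G : ℕ → ℕ → ℕ} → (∀ i j → F i j ≤ G i j) → cycleSum l F ≤ cycleSum l G
cycleSum-mono l F≤G = +-mono-≤ (sum<-mono l (λ i _ → F≤G i (suc i))) (F≤G l 0)

cycleSum-+ : ∀ l F G → cycleSum l (λ i j → F i j + G i j) ≡ cycleSum l F + cycleSum l G
cycleSum-+ l F G = trans (cong (λ t → t + (F l 0 + G l 0)) (sum<-+ l (λ i → F i (suc i)) (λ i → G i (suc i))))
                         (+-interchange (sum< l (λ i → F i (suc i))) _ (F l 0) (G l 0))

cycleSum-source : ∀ l f → cycleSum l (λ i _ → f i) ≡ sum< (suc l) f
cycleSum-source l f = sym (sum<-suc l f)

cycleSum-target : ∀ l f → cycleSum l (λ _ j → f j) ≡ sum< (suc l) f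
cycleSum-target l f = +-comm (sum< l (λ i → f (suc i))) (f 0)

cycleSum-∨≤count+count : ∀ l (α : ℕ → Bool) →
  cycleSum l (λ i j → bool→ℕ (α i ∨ α j)) ≤ count< (suc l) α + count< (suc l) α
cycleSum-∨≤count+count l α = begin
    cycleSum l (λ i j → bool→ℕ (α i ∨ α j))
  ≤⟨ cycleSum-mono l {λ i j → bool→ℕ (α i ∨ α j)} (λ i j → bool→ℕ-∨ (α i) (α j)) ⟩
    cycleSum l (λ i j → bool→ℕ (α i) + bool→ℕ (α j))
  ≡⟨ cycleSum-+ l (λ i _ → bool→ℕ (α i)) (λ _ j → bool→ℕ (α j)) ⟩
    cycleSum l (λ i _ → bool→ℕ (α i)) + cycleSum l (λ _ j → bool→ℕ (α j))
  ≡⟨ cong₂ _+_ (cycleSum-source l (λ i → bool→ℕ (α i))) (cycleSum-target l (λ i → bool→ℕ (α i))) ⟩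
    count< (suc l) α + count< (suc l) α ∎
  where open ≤-Reasoning

cycleSum-∨≤length : ∀ l (α : ℕ → Bool) → cycleSum l (λ i j → bool→ℕ (α i ∨ α j)) ≤ suc l
cycleSum-∨≤length l α = begin
    cycleSum l (λ i j → bool→ℕ (α i ∨ α j))
  ≤⟨ cycleSum-mono l {λ i j → bool→ℕ (α i ∨ α j)} (λ i j → bool→ℕ≤1 (α i ∨ α j)) ⟩
    cycleSum l (λ _ _ → 1)
  ≡⟨ cycleSum-source l (λ _ → 1) ⟩
    count< (suc l) (λ _ → true)
  ≡⟨ count<-true (suc l) ⟩
    suc l ∎
  where open ≤-Reasoning

-- Each edge i → j satisfies [α i ∨ α j] + [¬ α j] ≤ 1 + [α i]; summing around the cycle
-- counts every vertex once as a source and once as a target.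
cycleSum-∨+count-not≤ : ∀ l (α : ℕ → Bool) →
  cycleSum l (λ i j → bool→ℕ (α i ∨ α j)) + count< (suc l) (λ i → not (α i)) ≤ suc l + count< (suc l) α
cycleSum-∨+count-not≤ l α = begin
    cycleSum l (λ i j → bool→ℕ (α i ∨ α j)) + count< (suc l) (λ i → not (α i))
  ≡⟨ cong (_+_ (cycleSum l (λ i j → bool→ℕ (α i ∨ α j)))) (cycleSum-target l (λ i → bool→ℕ (not (α i)))) ⟨
    cycleSum l (λ i j → bool→ℕ (α i ∨ α j)) + cycleSum l (λ _ j → bool→ℕ (not (α j)))
  ≡⟨ cycleSum-+ l (λ i j → bool→ℕ (α i ∨ α j)) (λ _ j → bool→ℕ (not (α j))) ⟨
    cycleSum l (λ i j → bool→ℕ (α i ∨ α j) + bool→ℕ (not (α j)))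
  ≤⟨ cycleSum-mono l {λ i j → bool→ℕ (α i ∨ α j) + bool→ℕ (not (α j))}
                   (λ i j → bool→ℕ-∨-+-not (α i) (α j)) ⟩
    cycleSum l (λ i _ → 1 + bool→ℕ (α i))
  ≡⟨ cycleSum-source l (λ i → 1 + bool→ℕ (α i)) ⟩
    sum< (suc l) (λ i → 1 + bool→ℕ (α i))
  ≡⟨ sum<-+ (suc l) (λ _ → 1) (λ i → bool→ℕ (α i)) ⟩
    count< (suc l) (λ _ → true) + count< (suc l) α
  ≡⟨ cong (λ t → t + count< (suc l) α) (count<-true (suc l)) ⟩
    suc l + count< (suc l) α ∎
  where open ≤-Reasoning

module _ {A : Set} where

  length-filterᵇ-∷ : ∀ (P : A → Bool) x xs →
    length (filterᵇ P (x ∷ xs)) ≡ bool→ℕ (P x) + length (filterᵇ P xs)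
  length-filterᵇ-∷ P x xs with P x
  ... | true  = refl
  ... | false = refl

  length-filterᵇ-++ : ∀ (P : A → Bool) xs ys →
    length (filterᵇ P (xs ++ ys)) ≡ length (filterᵇ P xs) + length (filterᵇ P ys)
  length-filterᵇ-++ P []       ys = refl
  length-filterᵇ-++ P (x ∷ xs) ys
    rewrite length-filterᵇ-∷ P x (xs ++ ys) | length-filterᵇ-∷ P x xs | length-filterᵇ-++ P xs ys
    = sym (+-assoc (bool→ℕ (P x)) _ _)

  length-filterᵇ-mono : ∀ {P Q : A → Bool} → (∀ x → T (P x) → T (Q x)) → ∀ xs →
    length (filterᵇ P xs) ≤ length (filterᵇ Q xs)
  length-filterᵇ-mono         P⇒Q []       = z≤n
  length-filterᵇ-mono {P} {Q} P⇒Q (x ∷ xs)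
    rewrite length-filterᵇ-∷ P x xs | length-filterᵇ-∷ Q x xs
    = +-mono-≤ (bool→ℕ-mono (P⇒Q x)) (length-filterᵇ-mono P⇒Q xs)

  length-filterᵇ-false : ∀ xs → length (filterᵇ (λ (_ : A) → false) xs) ≡ 0
  length-filterᵇ-false []       = refl
  length-filterᵇ-false (x ∷ xs) = length-filterᵇ-false xs

  length-filterᵇ-filterᵇ : ∀ (P Q : A → Bool) xs →
    length (filterᵇ P (filterᵇ Q xs)) ≡ length (filterᵇ (λ x → Q x ∧ P x) xs)
  length-filterᵇ-filterᵇ P Q []       = refl
  length-filterᵇ-filterᵇ P Q (x ∷ xs)
    rewrite length-filterᵇ-∷ (λ x → Q x ∧ P x) x xs
    = trans (head x) (cong (_+_ (bool→ℕ (Q x ∧ P x))) (length-filterᵇ-filterᵇ P Q xs))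
    where
    head : ∀ x → length (filterᵇ P (filterᵇ Q (x ∷ xs))) ≡ bool→ℕ (Q x ∧ P x) + length (filterᵇ P (filterᵇ Q xs))
    head x with Q x
    ... | true  = length-filterᵇ-∷ P x (filterᵇ Q xs)
    ... | false = refl

module _ {A B : Set} where

  length-filterᵇ-map : ∀ (P : B → Bool) (f : A → B) xs →
    length (filterᵇ P (map f xs)) ≡ length (filterᵇ (P ∘ f) xs)
  length-filterᵇ-map P f []       = refl
  length-filterᵇ-map P f (x ∷ xs)
    rewrite length-filterᵇ-∷ P (f x) (map f xs) | length-filterᵇ-∷ (P ∘ f) x xs | length-filterᵇ-map P f xs
    = refl

  length-filterᵇ-concatMap : ∀ (P : B → Bool) (f : A → List B) xs →
    length (filterᵇ P (concatMap f xs)) ≡ sum (map (λ x → length (filterᵇ P (f x))) xs)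
  length-filterᵇ-concatMap P f []       = refl
  length-filterᵇ-concatMap P f (x ∷ xs)
    rewrite length-filterᵇ-++ P (f x) (concatMap f xs) | length-filterᵇ-concatMap P f xs
    = refl

length-filterᵇ-tabulate : ∀ {A : Set} n (h : Fin n → A) (P : A → Bool) (f : ℕ → Bool) →
  (∀ i → P (h i) ≡ f (toℕ i)) → length (filterᵇ P (tabulate h)) ≡ count< n f
length-filterᵇ-tabulate zero    h P f Ph≡f = refl
length-filterᵇ-tabulate (suc n) h P f Ph≡f
  rewrite length-filterᵇ-∷ P (h Fin.zero) (tabulate (h ∘ Fin.suc)) | Ph≡f Fin.zero
  = cong (_+_ (bool→ℕ (f 0))) (length-filterᵇ-tabulate n (h ∘ Fin.suc) P (f ∘ suc) (Ph≡f ∘ Fin.suc))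

sum-map-tabulate : ∀ {A : Set} n (h : Fin n → A) (G : A → ℕ) (F : ℕ → ℕ) →
  (∀ i → G (h i) ≡ F (toℕ i)) → sum (map G (tabulate h)) ≡ sum< n F
sum-map-tabulate zero    h G F Gh≡F = refl
sum-map-tabulate (suc n) h G F Gh≡F =
  cong₂ _+_ (Gh≡F Fin.zero) (sum-map-tabulate n (h ∘ Fin.suc) G (F ∘ suc) (Gh≡F ∘ Fin.suc))

length-filterᵇ-edges : ∀ {n} (G : Graph n) (g : ℕ → ℕ → Bool) → (∀ i j → G i j ≡ g (toℕ i) (toℕ j)) →
  (P : ℕ → ℕ → Bool) →
  length (filterᵇ (λ e → P (toℕ (proj₁ e)) (toℕ (proj₂ e))) (edges G)) ≡ countPairs< n (λ a b → g a b ∧ P a b)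
length-filterᵇ-edges {n} G g G≡g P =
  trans (length-filterᵇ-concatMap P′ _ (allFin n)) (sum-map-tabulate n (λ i → i) _ _ row)
  where
  P′ : Fin n × Fin n → Bool
  P′ e = P (toℕ (proj₁ e)) (toℕ (proj₂ e))
  above : Fin n → Fin n → Bool
  above i j = (toℕ i <ᵇ toℕ j) ∧ G i j
  row : ∀ i → length (filterᵇ P′ (map (i ,_) (filterᵇ (above i) (allFin n))))
            ≡ count< n (λ b → (toℕ i <ᵇ b) ∧ (g (toℕ i) b ∧ P (toℕ i) b))
  row i = begin
      length (filterᵇ P′ (map (i ,_) (filterᵇ (above i) (allFin n))))
    ≡⟨ length-filterᵇ-map P′ (i ,_) (filterᵇ (above i) (allFin n)) ⟩
      length (filterᵇ (λ j → P (toℕ i) (toℕ j)) (filterᵇ (above i) (allFin n)))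
    ≡⟨ length-filterᵇ-filterᵇ (λ j → P (toℕ i) (toℕ j)) (above i) (allFin n) ⟩
      length (filterᵇ (λ j → above i j ∧ P (toℕ i) (toℕ j)) (allFin n))
    ≡⟨ length-filterᵇ-tabulate n (λ j → j) _ _ (λ j →
         trans (cong (λ t → ((toℕ i <ᵇ toℕ j) ∧ t) ∧ P (toℕ i) (toℕ j)) (G≡g i j)) (∧-assoc (toℕ i <ᵇ toℕ j) _ _)) ⟩
      count< n (λ b → (toℕ i <ᵇ b) ∧ (g (toℕ i) b ∧ P (toℕ i) b)) ∎
    where open ≡-Reasoning

onℕ : ∀ {n} → (Fin n → Bool) → ℕ → Bool
onℕ {zero}  f m       = false
onℕ {suc n} f zero    = f Fin.zero
onℕ {suc n} f (suc m) = onℕ (f ∘ Fin.suc) m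

onℕ-toℕ : ∀ {n} (f : Fin n → Bool) i → onℕ f (toℕ i) ≡ f i
onℕ-toℕ {suc n} f Fin.zero    = refl
onℕ-toℕ {suc n} f (Fin.suc i) = onℕ-toℕ (f ∘ Fin.suc) i

diff≤diff : ∀ x y z w → x + w ≤ z + y → + x - + y ℤ.≤ + z - + w
diff≤diff x y z w x+w≤z+y = begin
    + x - + y          ≡⟨ [+m]-[+n]≡m⊖n x y ⟩
    x ⊖ y              ≡⟨ +-cancelˡ-⊖ w x y ⟨
    (w + x) ⊖ (w + y)  ≤⟨ ⊖-monoˡ-≤ (w + y) w+x≤y+z ⟩
    (y + z) ⊖ (w + y)  ≡⟨ cong ((y + z) ⊖_) (+-comm w y) ⟩
    (y + z) ⊖ (y + w)  ≡⟨ +-cancelˡ-⊖ y z w ⟩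
    z ⊖ w              ≡⟨ [+m]-[+n]≡m⊖n z w ⟨
    + z - + w          ∎
  where
  open ℤ.≤-Reasoning
  w+x≤y+z : w + x ≤ y + z
  w+x≤y+z = subst₂ _≤_ (+-comm x w) (+-comm z y) x+w≤z+y

-- The boundary in R(G)

-- Counting is over ℕ-indexed predicates, so G is also given as an adjacency g on ℕ.
module _ {n : ℕ} (G : Graph n) (g : ℕ → ℕ → Bool) (G≡g : ∀ i j → G i j ≡ g (toℕ i) (toℕ j)) where

  private
    Vertex : Set
    Vertex = Fin n ⊎ (Fin n × Fin n)

    boundary : (Vertex → Bool) → Vertex → Bool
    boundary S v = not (S v) ∧ any (λ u → S u ∧ ladj (R G) u v) (verts (R G))

    length-filterᵇ-verts : ∀ P → length (filterᵇ P (verts (R G)))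
      ≡ length (filterᵇ (P ∘ inj₁) (allFin n)) + length (filterᵇ (P ∘ inj₂) (edges G))
    length-filterᵇ-verts P = trans (length-filterᵇ-++ P (map inj₁ (allFin n)) (map inj₂ (edges G)))
      (cong₂ _+_ (length-filterᵇ-map P inj₁ (allFin n)) (length-filterᵇ-map P inj₂ (edges G)))

    inj₁∈verts : ∀ i → inj₁ i ∈ verts (R G)
    inj₁∈verts i = ∈-++⁺ˡ (∈-map⁺ inj₁ (∈-allFin i))

    boundary-intro : ∀ S {u} v → u ∈ verts (R G) →
      T (not (S v)) → T (S u) → T (ladj (R G) u v) → T (boundary S v)
    boundary-intro S v u∈V v∉S u∈S uv = from T-∧ (v∉S , any⁺ _ (lose u∈V (from T-∧ (u∈S , uv))))

  vertexPart : (Vertex → Bool) → ℕ → Bool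
  vertexPart S = onℕ (λ i → S (inj₁ i))

  private
    vertexPart-intro : ∀ S i {m} → T (S (inj₁ i)) → toℕ i ≡ m → T (vertexPart S m)
    vertexPart-intro S i i∈S refl = subst T (sym (onℕ-toℕ (λ i → S (inj₁ i)) i)) i∈S

    boundary-inj₂ : ∀ S x y → T (boundary S (inj₂ (x , y))) →
      T (vertexPart S (toℕ x) ∨ vertexPart S (toℕ y))
    boundary-inj₂ S x y h with satisfied (any⁻ _ (verts (R G)) (proj₂ (to T-∧ h)))
    ... | inj₂ e , e∈S∧false = ⊥-elim (proj₂ (to T-∧ e∈S∧false))
    ... | inj₁ i , i∈S∧i∈xy with to T-∧ i∈S∧i∈xy
    ...   | i∈S , i∈xy with to T-∨ i∈xy
    ...     | inj₁ i≡x = from T-∨ (inj₁ (vertexPart-intro S i i∈S (≡ᵇ⇒≡ (toℕ i) (toℕ x) i≡x)))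
    ...     | inj₂ i≡y = from T-∨ (inj₂ (vertexPart-intro S i i∈S (≡ᵇ⇒≡ (toℕ i) (toℕ y) i≡y)))

  card-R-≥ : ∀ S → count< n (vertexPart S) ≤ card (R G) S
  card-R-≥ S = begin
      count< n (vertexPart S)
    ≡⟨ length-filterᵇ-tabulate n (λ i → i) (S ∘ inj₁) (vertexPart S) (λ i → sym (onℕ-toℕ _ i)) ⟨
      length (filterᵇ (S ∘ inj₁) (allFin n))
    ≤⟨ m≤m+n _ _ ⟩
      length (filterᵇ (S ∘ inj₁) (allFin n)) + length (filterᵇ (S ∘ inj₂) (edges G))
    ≡⟨ length-filterᵇ-verts S ⟨
      card (R G) S ∎
    where open ≤-Reasoning

  B-R-≤ : ∀ S → length (B (R G) S) ≤ count< n (λ i → not (vertexPart S i)) + edgesMeeting n g (vertexPart S)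
  B-R-≤ S = begin
      length (B (R G) S)
    ≡⟨ length-filterᵇ-verts (boundary S) ⟩
      length (filterᵇ (boundary S ∘ inj₁) (allFin n)) + length (filterᵇ (boundary S ∘ inj₂) (edges G))
    ≤⟨ +-mono-≤ (length-filterᵇ-mono (λ i h → proj₁ (to T-∧ h)) (allFin n))
                (length-filterᵇ-mono (λ (x , y) → boundary-inj₂ S x y) (edges G)) ⟩
      length (filterᵇ (λ i → not (S (inj₁ i))) (allFin n))
        + length (filterᵇ (λ e → α (toℕ (proj₁ e)) ∨ α (toℕ (proj₂ e))) (edges G))
    ≡⟨ cong₂ _+_ (length-filterᵇ-tabulate n (λ i → i) _ _ (λ i → cong not (sym (onℕ-toℕ _ i))))
                 (length-filterᵇ-edges G g G≡g (λ a b → α a ∨ α b)) ⟩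
      count< n (λ i → not (α i)) + edgesMeeting n g α ∎
    where
    open ≤-Reasoning
    α = vertexPart S

  onVertices : (ℕ → Bool) → Vertex → Bool
  onVertices β (inj₁ i) = β (toℕ i)
  onVertices β (inj₂ _) = false

  card-onVertices : ∀ β → card (R G) (onVertices β) ≡ count< n β
  card-onVertices β = trans (length-filterᵇ-verts (onVertices β))
    (trans (cong₂ _+_ (length-filterᵇ-tabulate n (λ i → i) _ β (λ _ → refl)) (length-filterᵇ-false (edges G)))
           (+-identityʳ _))

  B-onVertices-≥ : ∀ β c → T (β (toℕ c)) →
    count< n (λ j → not (β j) ∧ g (toℕ c) j) + edgesMeeting n g β ≤ length (B (R G) (onVertices β))
  B-onVertices-≥ β c c∈β = begin
      count< n (λ j → not (β j) ∧ g (toℕ c) j) + edgesMeeting n g β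
    ≡⟨ cong₂ _+_ (length-filterᵇ-tabulate n (λ j → j) _ _ (λ j → cong (_∧_ (not (β (toℕ j)))) (G≡g c j)))
                 (length-filterᵇ-edges G g G≡g (λ a b → β a ∨ β b)) ⟨
      length (filterᵇ (λ j → not (β (toℕ j)) ∧ G c j) (allFin n))
        + length (filterᵇ (λ e → β (toℕ (proj₁ e)) ∨ β (toℕ (proj₂ e))) (edges G))
    ≤⟨ +-mono-≤ (length-filterᵇ-mono neighbour (allFin n)) (length-filterᵇ-mono meets (edges G)) ⟩
      length (filterᵇ (boundary S ∘ inj₁) (allFin n)) + length (filterᵇ (boundary S ∘ inj₂) (edges G))
    ≡⟨ length-filterᵇ-verts (boundary S) ⟨
      length (B (R G) S) ∎
    where
    open ≤-Reasoning
    S = onVertices β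
    neighbour : ∀ j → T (not (β (toℕ j)) ∧ G c j) → T (boundary S (inj₁ j))
    neighbour j h = boundary-intro S (inj₁ j) (inj₁∈verts c) (proj₁ (to T-∧ h)) c∈β (proj₂ (to T-∧ h))
    meets : ∀ e → T (β (toℕ (proj₁ e)) ∨ β (toℕ (proj₂ e))) → T (boundary S (inj₂ e))
    meets (x , y) h with to T-∨ h
    ... | inj₁ x∈β = boundary-intro S (inj₂ (x , y)) (inj₁∈verts x) _ x∈β (from T-∨ (inj₁ (≡⇒≡ᵇ (toℕ x) _ refl)))
    ... | inj₂ y∈β = boundary-intro S (inj₂ (x , y)) (inj₁∈verts y) _ y∈β (from T-∨ (inj₂ (≡⇒≡ᵇ (toℕ y) _ refl)))

  ∂Is-R : (z w : ℕ) →
    (∀ α → count< n (λ i → not (α i)) + edgesMeeting n g α + w ≤ z + count< n α) →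
    (β : ℕ → Bool) (c : Fin n) → T (β (toℕ c)) →
    z + count< n β ≤ count< n (λ j → not (β j) ∧ g (toℕ c) j) + edgesMeeting n g β + w →
    ∂Is (R G) (+ z - + w)
  ∂Is-R z w upper β c c∈β lower =
    (onVertices β , ℤ.≤-antisym (∂ₛ-≤ (onVertices β)) (diff≤diff z w _ _ attained)) , ∂ₛ-≤
    where
    open ≤-Reasoning
    bound : ∀ S → length (B (R G) S) + w ≤ z + card (R G) S
    bound S = begin
        length (B (R G) S) + w
      ≤⟨ +-monoˡ-≤ w (B-R-≤ S) ⟩
        count< n (λ i → not (vertexPart S i)) + edgesMeeting n g (vertexPart S) + w
      ≤⟨ upper (vertexPart S) ⟩
        z + count< n (vertexPart S)
      ≤⟨ +-monoʳ-≤ z (card-R-≥ S) ⟩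
        z + card (R G) S ∎
    ∂ₛ-≤ : ∀ S → ∂ₛ (R G) S ℤ.≤ + z - + w
    ∂ₛ-≤ S = diff≤diff _ _ z w (bound S)
    attained : z + card (R G) (onVertices β) ≤ length (B (R G) (onVertices β)) + w
    attained = begin
        z + card (R G) (onVertices β)
      ≡⟨ cong (_+_ z) (card-onVertices β) ⟩
        z + count< n β
      ≤⟨ lower ⟩
        count< n (λ j → not (β j) ∧ g (toℕ c) j) + edgesMeeting n g β + w
      ≤⟨ +-monoˡ-≤ w (B-onVertices-≥ β c c∈β) ⟩
        length (B (R G) (onVertices β)) + w ∎

-- Complete graphs

choose2 : ℕ → ℕ
choose2 zero    = 0
choose2 (suc k) = choose2 k + k

choose2*2 : ∀ n → choose2 n * 2 ≡ n * (n ∸ 1)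
choose2*2 zero          = refl
choose2*2 (suc zero)    = refl
choose2*2 (suc (suc k)) = begin
    (choose2 (suc k) + suc k) * 2      ≡⟨ *-distribʳ-+ 2 (choose2 (suc k)) (suc k) ⟩
    choose2 (suc k) * 2 + suc k * 2    ≡⟨ cong (λ t → t + suc k * 2) (choose2*2 (suc k)) ⟩
    suc k * k + suc k * 2              ≡⟨ *-distribˡ-+ (suc k) k 2 ⟨
    suc k * (k + 2)                    ≡⟨ *-comm (suc k) (k + 2) ⟩
    (k + 2) * suc k                    ≡⟨ cong (_* suc k) (+-comm k 2) ⟩
    suc (suc k) * suc k                ∎
  where open ≡-Reasoning

n*[n∸1]/2≡choose2 : ∀ n → n * (n ∸ 1) / 2 ≡ choose2 n
n*[n∸1]/2≡choose2 n = trans (cong (_/ 2) (sym (choose2*2 n))) (m*n/n≡m (choose2 n) 2)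

2*k≤choose2+3 : ∀ k → 2 * k ≤ choose2 k + 3
2*k≤choose2+3 0 = z≤n
2*k≤choose2+3 1 = s≤s (s≤s z≤n)
2*k≤choose2+3 2 = ≤-refl
2*k≤choose2+3 (suc (suc (suc k))) = begin
    2 * (3 + k)                          ≡⟨ *-suc 2 (2 + k) ⟩
    2 + 2 * (2 + k)                      ≤⟨ +-mono-≤ (s≤s (s≤s (z≤n {k}))) (2*k≤choose2+3 (suc (suc k))) ⟩
    (2 + k) + (choose2 (2 + k) + 3)      ≡⟨ +-assoc (2 + k) (choose2 (2 + k)) 3 ⟨
    (2 + k) + choose2 (2 + k) + 3        ≡⟨ cong (λ t → t + 3) (+-comm (2 + k) (choose2 (2 + k))) ⟩
    choose2 (2 + k) + (2 + k) + 3        ∎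
  where open ≤-Reasoning

completeAdj : ℕ → ℕ → Bool
completeAdj a b = not (a ≡ᵇ b)

-- Edges not meeting α are exactly those inside its complement.
edgesMeeting-complete : ∀ m (α : ℕ → Bool) →
  edgesMeeting m completeAdj α + choose2 (count< m (λ i → not (α i))) ≡ choose2 m
edgesMeeting-complete zero    α = refl
edgesMeeting-complete (suc m) α = begin
    edgesMeeting (suc m) completeAdj α + choose2 (count< (suc m) (λ i → not (α i)))
  ≡⟨ cong₂ _+_ (countPairs<-suc m (λ a b → completeAdj a b ∧ (α a ∨ α b)))
               (cong choose2 (count<-suc m (λ i → not (α i)))) ⟩
    (E + count< m (λ i → completeAdj i m ∧ (α i ∨ α m))) + choose2 (k + bool→ℕ (not (α m)))
  ≡⟨ cong (λ t → (E + t) + choose2 (k + bool→ℕ (not (α m))))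
          (count<-cong m (λ i i<m → cong (λ t → not t ∧ (α i ∨ α m)) (≢⇒≡ᵇ≡false i m (<⇒≢ i<m)))) ⟩
    (E + count< m (λ i → α i ∨ α m)) + choose2 (k + bool→ℕ (not (α m)))
  ≡⟨ newVertex (α m) ⟩
    choose2 m + m ∎
  where
  open ≡-Reasoning
  E = edgesMeeting m completeAdj α
  k = count< m (λ i → not (α i))
  newVertex : ∀ b → (E + count< m (λ i → α i ∨ b)) + choose2 (k + bool→ℕ (not b)) ≡ choose2 m + m
  newVertex true = begin
      (E + count< m (λ i → α i ∨ true)) + choose2 (k + 0)
    ≡⟨ cong₂ (λ s t → (E + s) + choose2 t) (count<-∨-true m α) (+-identityʳ k) ⟩
      (E + m) + choose2 k
    ≡⟨ +-right-comm E m (choose2 k) ⟩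
      (E + choose2 k) + m
    ≡⟨ cong (λ t → t + m) (edgesMeeting-complete m α) ⟩
      choose2 m + m ∎
  newVertex false = begin
      (E + count< m (λ i → α i ∨ false)) + choose2 (k + 1)
    ≡⟨ cong₂ (λ s t → (E + s) + choose2 t) (count<-∨-false m α) (+-comm k 1) ⟩
      (E + count< m α) + (choose2 k + k)
    ≡⟨ +-interchange E (count< m α) (choose2 k) k ⟩
      (E + choose2 k) + (count< m α + k)
    ≡⟨ cong₂ _+_ (edgesMeeting-complete m α) (count<-+-count<-not m α) ⟩
      choose2 m + m ∎

∂-R-K : ∀ t → ∂Is (R (K (3 + t))) (+ (choose2 (3 + t) + 3) - + (3 + t))
∂-R-K t = ∂Is-R (K n) completeAdj (λ _ _ → refl) (choose2 n + 3) n upper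
  notFirstTwo (Fin.suc (Fin.suc Fin.zero)) _ lower
  where
  n = 3 + t
  upper : ∀ α → count< n (λ i → not (α i)) + edgesMeeting n completeAdj α + n ≤ (choose2 n + 3) + count< n α
  upper α = subst (λ m → k + E + m ≤ (choose2 n + 3) + a) (count<-+-count<-not n α) (begin
      k + E + (a + k)              ≡⟨ reorder₁ k E a ⟩
      (E + a) + 2 * k              ≤⟨ +-monoʳ-≤ (E + a) (2*k≤choose2+3 k) ⟩
      (E + a) + (choose2 k + 3)    ≡⟨ reorder₂ E a (choose2 k) ⟩
      (E + choose2 k + 3) + a      ≡⟨ cong (λ c → (c + 3) + a) (edgesMeeting-complete n α) ⟩
      (choose2 n + 3) + a          ∎)
    where
    open ≤-Reasoning
    k = count< n (λ i → not (α i))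
    a = count< n α
    E = edgesMeeting n completeAdj α
    reorder₁ : ∀ k E a → k + E + (a + k) ≡ (E + a) + 2 * k
    reorder₁ = solve-∀
    reorder₂ : ∀ E a c → (E + a) + (c + 3) ≡ (E + c + 3) + a
    reorder₂ = solve-∀
  notFirstTwo : ℕ → Bool
  notFirstTwo j = not (j <ᵇ 2)
  lower : (choose2 n + 3) + count< n notFirstTwo
        ≤ count< n (λ j → not (notFirstTwo j) ∧ completeAdj 2 j) + edgesMeeting n completeAdj notFirstTwo + n
  lower = ≤-reflexive (begin
      (choose2 n + 3) + count< (suc t) (λ _ → true)
    ≡⟨ cong₂ (λ c s → (c + 3) + s) (sym (edgesMeeting-complete n notFirstTwo)) (count<-true (suc t)) ⟩
      (E + choose2 (2 + count< (suc t) (λ _ → false)) + 3) + suc t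
    ≡⟨ cong (λ c → (E + choose2 (2 + c) + 3) + suc t) (count<-false (suc t)) ⟩
      (E + 1 + 3) + suc t
    ≡⟨ reorder E t ⟩
      2 + E + n
    ≡⟨ cong (λ c → 2 + c + E + n) (count<-false (suc t)) ⟨
      (2 + count< (suc t) (λ _ → false)) + E + n ∎)
    where
    open ≡-Reasoning
    E = edgesMeeting n completeAdj notFirstTwo
    reorder : ∀ E t → (E + 1 + 3) + suc t ≡ 2 + E + (3 + t)
    reorder = solve-∀

-- Complete bipartite graphs

bipartiteAdj : ℕ → ℕ → ℕ → Bool
bipartiteAdj p a b = (a <ᵇ p) xor (b <ᵇ p)

edgesMeeting-bipartite-part : ∀ p α m → m ≤ p → edgesMeeting m (bipartiteAdj p) α ≡ 0
edgesMeeting-bipartite-part p α zero    _   = refl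
edgesMeeting-bipartite-part p α (suc m) m<p = begin
    edgesMeeting (suc m) (bipartiteAdj p) α
  ≡⟨ countPairs<-suc m (λ a b → bipartiteAdj p a b ∧ (α a ∨ α b)) ⟩
    edgesMeeting m (bipartiteAdj p) α + count< m (λ i → bipartiteAdj p i m ∧ (α i ∨ α m))
  ≡⟨ cong₂ _+_ (edgesMeeting-bipartite-part p α m (<⇒≤ m<p)) (trans (count<-cong m sameSide) (count<-false m)) ⟩
    0 ∎
  where
  open ≡-Reasoning
  sameSide : ∀ i → i < m → bipartiteAdj p i m ∧ (α i ∨ α m) ≡ false
  sameSide i i<m = cong₂ (λ x y → (x xor y) ∧ (α i ∨ α m)) (<⇒<ᵇ≡true (<-trans i<m m<p)) (<⇒<ᵇ≡true m<p)

-- This is pq − k₁k₂: an edge misses α iff both of its ends lie outside α.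
edgesMeeting-bipartite : ∀ p α t → edgesMeeting (p + t) (bipartiteAdj p) α
  ≡ p * count< t (λ i → α (p + i)) + count< p α * count< t (λ i → not (α (p + i)))
edgesMeeting-bipartite p α zero = begin
    edgesMeeting (p + 0) (bipartiteAdj p) α   ≡⟨ edgesMeeting-bipartite-part p α (p + 0) (≤-reflexive (+-identityʳ p)) ⟩
    0                                        ≡⟨ cong₂ _+_ (*-zeroʳ p) (*-zeroʳ (count< p α)) ⟨
    p * 0 + count< p α * 0                    ∎
  where open ≡-Reasoning
edgesMeeting-bipartite p α (suc t) = begin
    edgesMeeting (p + suc t) (bipartiteAdj p) α
  ≡⟨ cong (λ m → edgesMeeting m (bipartiteAdj p) α) (+-suc p t) ⟩
    edgesMeeting (suc (p + t)) (bipartiteAdj p) α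
  ≡⟨ countPairs<-suc (p + t) (λ a b → bipartiteAdj p a b ∧ (α a ∨ α b)) ⟩
    edgesMeeting (p + t) (bipartiteAdj p) α + count< (p + t) (λ i → bipartiteAdj p i (p + t) ∧ (α i ∨ α (p + t)))
  ≡⟨ cong₂ _+_ (edgesMeeting-bipartite p α t) newColumn ⟩
    (p * a₂ + a₁ * k₂) + count< p (λ i → α i ∨ α (p + t))
  ≡⟨ newVertex (α (p + t)) ⟩
    p * (a₂ + bool→ℕ (α (p + t))) + a₁ * (k₂ + bool→ℕ (not (α (p + t))))
  ≡⟨ cong₂ (λ x y → p * x + a₁ * y) (count<-suc t (λ i → α (p + i))) (count<-suc t (λ i → not (α (p + i)))) ⟨
    p * count< (suc t) (λ i → α (p + i)) + a₁ * count< (suc t) (λ i → not (α (p + i))) ∎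
  where
  open ≡-Reasoning
  a₁ = count< p α
  a₂ = count< t (λ i → α (p + i))
  k₂ = count< t (λ i → not (α (p + i)))
  newColumn : count< (p + t) (λ i → bipartiteAdj p i (p + t) ∧ (α i ∨ α (p + t))) ≡ count< p (λ i → α i ∨ α (p + t))
  newColumn = trans (count<-cong (p + t) (λ i _ → trans
      (cong (λ x → ((i <ᵇ p) xor x) ∧ (α i ∨ α (p + t))) (≤⇒<ᵇ≡false (m≤m+n p t)))
      (cong (λ x → x ∧ (α i ∨ α (p + t))) (xor-identityʳ (i <ᵇ p)))))
    (count<-<ᵇ-∧ p t (λ i → α i ∨ α (p + t)))
  newVertex : ∀ b → (p * a₂ + a₁ * k₂) + count< p (λ i → α i ∨ b)
                  ≡ p * (a₂ + bool→ℕ b) + a₁ * (k₂ + bool→ℕ (not b))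
  newVertex true  = trans (cong (_+_ (p * a₂ + a₁ * k₂)) (count<-∨-true p α)) (addToFirst p a₂ a₁ k₂)
    where
    addToFirst : ∀ p a₂ a₁ k₂ → (p * a₂ + a₁ * k₂) + p ≡ p * (a₂ + 1) + a₁ * (k₂ + 0)
    addToFirst = solve-∀
  newVertex false = trans (cong (_+_ (p * a₂ + a₁ * k₂)) (count<-∨-false p α)) (addToSecond p a₂ a₁ k₂)
    where
    addToSecond : ∀ p a₂ a₁ k₂ → (p * a₂ + a₁ * k₂) + a₁ ≡ p * (a₂ + 0) + a₁ * (k₂ + 1)
    addToSecond = solve-∀

-- aᵢ and kᵢ count the vertices of part i inside and outside α.
2*k₁≤2*a₂+k₁*k₂ : ∀ a₁ k₁ a₂ k₂ → a₁ + k₁ ≤ a₂ + k₂ → 4 ≤ a₁ + k₁ + (a₂ + k₂) →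
  2 * k₁ ≤ 2 * a₂ + k₁ * k₂
2*k₁≤2*a₂+k₁*k₂ a₁ k₁ a₂ zero p≤q _ = begin
    2 * k₁         ≤⟨ *-monoʳ-≤ 2 (≤-trans (m≤n+m k₁ a₁) (≤-trans p≤q (≤-reflexive (+-identityʳ a₂)))) ⟩
    2 * a₂         ≤⟨ m≤m+n (2 * a₂) _ ⟩
    2 * a₂ + k₁ * 0 ∎
  where open ≤-Reasoning
2*k₁≤2*a₂+k₁*k₂ a₁ k₁ zero (suc zero) p≤q 4≤p+q with ≤-trans 4≤p+q (+-monoˡ-≤ 1 p≤q)
... | s≤s (s≤s ())
2*k₁≤2*a₂+k₁*k₂ a₁ k₁ (suc a₂) (suc zero) p≤q _ = begin
    2 * k₁                   ≡⟨ cong (_+_ k₁) (+-identityʳ k₁) ⟩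
    k₁ + k₁                  ≤⟨ +-monoˡ-≤ k₁ (≤-trans (m≤n+m k₁ a₁) (≤-trans p≤q (≤-reflexive (+-comm (suc a₂) 1)))) ⟩
    2 + a₂ + k₁              ≤⟨ +-monoˡ-≤ k₁ (s≤s (s≤s (m≤n+m a₂ a₂))) ⟩
    2 + (a₂ + a₂) + k₁       ≡⟨ cong (λ t → t + k₁) (double a₂) ⟩
    2 * suc a₂ + k₁          ≡⟨ cong (_+_ (2 * suc a₂)) (*-identityʳ k₁) ⟨
    2 * suc a₂ + k₁ * 1      ∎
  where
  open ≤-Reasoning
  double : ∀ a → 2 + (a + a) ≡ 2 * suc a
  double = solve-∀
2*k₁≤2*a₂+k₁*k₂ a₁ k₁ a₂ (suc (suc k₂)) _ _ =
  ≤-trans (≤-trans (≤-reflexive (*-comm 2 k₁)) (*-monoʳ-≤ k₁ (s≤s (s≤s z≤n)))) (m≤n+m _ _)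

bipartite-bound : ∀ {p q} a₁ k₁ a₂ k₂ → a₁ + k₁ ≡ p → a₂ + k₂ ≡ q → p ≤ q → 4 ≤ p + q →
  (k₁ + k₂) + (p * a₂ + a₁ * k₂) + p ≤ q * (p + 1) + (a₁ + a₂)
bipartite-bound a₁ k₁ a₂ k₂ refl refl p≤q 4≤p+q = +-cancelʳ-≤ (2 * a₂ + k₁ * k₂) _ _ (begin
    (k₁ + k₂) + ((a₁ + k₁) * a₂ + a₁ * k₂) + (a₁ + k₁) + (2 * a₂ + k₁ * k₂)
  ≡⟨ expand a₁ k₁ a₂ k₂ ⟩
    (a₂ + k₂) * ((a₁ + k₁) + 1) + (a₁ + a₂) + 2 * k₁
  ≤⟨ +-monoʳ-≤ ((a₂ + k₂) * ((a₁ + k₁) + 1) + (a₁ + a₂)) (2*k₁≤2*a₂+k₁*k₂ a₁ k₁ a₂ k₂ p≤q 4≤p+q) ⟩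
    (a₂ + k₂) * ((a₁ + k₁) + 1) + (a₁ + a₂) + (2 * a₂ + k₁ * k₂) ∎)
  where
  open ≤-Reasoning
  expand : ∀ a₁ k₁ a₂ k₂ → (k₁ + k₂) + ((a₁ + k₁) * a₂ + a₁ * k₂) + (a₁ + k₁) + (2 * a₂ + k₁ * k₂)
                         ≡ (a₂ + k₂) * ((a₁ + k₁) + 1) + (a₁ + a₂) + 2 * k₁
  expand = solve-∀

∂-R-Kbip : ∀ p q → 1 ≤ p → p ≤ q → 4 ≤ p + q → ∂Is (R (Kbip p q)) (+ (q * (p + 1)) - + p)
∂-R-Kbip (suc p′) q _ p≤q 4≤p+q = ∂Is-R (Kbip p q) (bipartiteAdj p) (λ _ _ → refl) (q * (p + 1)) p upper
  firstPart Fin.zero _ lower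
  where
  p = suc p′
  upper : ∀ α → count< (p + q) (λ i → not (α i)) + edgesMeeting (p + q) (bipartiteAdj p) α + p
              ≤ q * (p + 1) + count< (p + q) α
  upper α = begin
      count< (p + q) (λ i → not (α i)) + edgesMeeting (p + q) (bipartiteAdj p) α + p
    ≡⟨ cong₂ (λ k E → k + E + p) (count<-+-range p q (λ i → not (α i))) (edgesMeeting-bipartite p α q) ⟩
      (k₁ + k₂) + (p * a₂ + a₁ * k₂) + p
    ≤⟨ bipartite-bound a₁ k₁ a₂ k₂ (count<-+-count<-not p α) (count<-+-count<-not q (λ i → α (p + i))) p≤q 4≤p+q ⟩
      q * (p + 1) + (a₁ + a₂)
    ≡⟨ cong (_+_ (q * (p + 1))) (count<-+-range p q α) ⟨
      q * (p + 1) + count< (p + q) α ∎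
    where
    open ≤-Reasoning
    a₁ = count< p α
    k₁ = count< p (λ i → not (α i))
    a₂ = count< q (λ i → α (p + i))
    k₂ = count< q (λ i → not (α (p + i)))
  firstPart : ℕ → Bool
  firstPart j = j <ᵇ p
  inFirst : ∀ i → i < p → firstPart i ≡ true
  inFirst i = <⇒<ᵇ≡true
  notInSecond : ∀ i → firstPart (p + i) ≡ false
  notInSecond i = ≤⇒<ᵇ≡false (m≤m+n p i)
  lower : q * (p + 1) + count< (p + q) firstPart
        ≤ count< (p + q) (λ j → not (firstPart j) ∧ bipartiteAdj p 0 j) + edgesMeeting (p + q) (bipartiteAdj p) firstPart + p
  lower = ≤-reflexive (begin
      q * (p + 1) + count< (p + q) firstPart
    ≡⟨ cong (_+_ (q * (p + 1))) (count<-+-range p q firstPart) ⟩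
      q * (p + 1) + (count< p firstPart + count< q (λ i → firstPart (p + i)))
    ≡⟨ cong₂ (λ x y → q * (p + 1) + (x + y)) first second ⟩
      q * (p + 1) + (p + 0)
    ≡⟨ rearrange q p′ ⟩
      (0 + q) + (p * 0 + p * q) + p
    ≡⟨ cong₂ (λ x y → (x + y) + p) outsideNeighbours edgesMet ⟨
      count< (p + q) (λ j → not (firstPart j) ∧ bipartiteAdj p 0 j) + edgesMeeting (p + q) (bipartiteAdj p) firstPart + p ∎)
    where
    open ≡-Reasoning
    first : count< p firstPart ≡ p
    first = trans (count<-cong p inFirst) (count<-true p)
    second : count< q (λ i → firstPart (p + i)) ≡ 0
    second = trans (count<-cong q (λ i _ → notInSecond i)) (count<-false q)
    third : count< q (λ i → not (firstPart (p + i))) ≡ q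
    third = trans (count<-cong q (λ i _ → cong not (notInSecond i))) (count<-true q)
    edgesMet : edgesMeeting (p + q) (bipartiteAdj p) firstPart ≡ p * 0 + p * q
    edgesMet = trans (edgesMeeting-bipartite p firstPart q) (cong₂ (λ x y → p * x + y) second (cong₂ _*_ first third))
    rearrange : ∀ q p′ → q * (suc p′ + 1) + (suc p′ + 0) ≡ (0 + q) + (suc p′ * 0 + suc p′ * q) + suc p′
    rearrange = solve-∀
    outsideNeighbours : count< (p + q) (λ j → not (firstPart j) ∧ bipartiteAdj p 0 j) ≡ 0 + q
    outsideNeighbours = trans (count<-+-range p q (λ j → not (firstPart j) ∧ not (firstPart j))) (cong₂ _+_
      (trans (count<-cong p (λ i i<p → cong (λ x → not x ∧ not x) (inFirst i i<p))) (count<-false p))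
      (trans (count<-cong q (λ i _ → cong (λ x → not x ∧ not x) (notInSecond i))) (count<-true q)))

-- Wheels

-- `W n i` reduces to `wheelAdj n (toℕ i)`.
wheelAdj : ℕ → ℕ → ℕ → Bool
wheelAdj n a b = (z a ∧ not (z b)) ∨ (z b ∧ not (z a)) ∨ (not (z a) ∧ not (z b) ∧ cyc a b)
  where
  z : ℕ → Bool
  z a = a ≡ᵇ 0
  cyc : ℕ → ℕ → Bool
  cyc a b = (suc a ≡ᵇ b) ∨ (suc b ≡ᵇ a)
          ∨ ((a ≡ᵇ 1) ∧ (b ≡ᵇ (n ∸ 1))) ∨ ((b ≡ᵇ 1) ∧ (a ≡ᵇ (n ∸ 1)))

-- Vertex 0 is the hub and 1, …, l + 1 the rim; edges are counted by their larger end.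
edgesMeeting-wheel : ∀ l (α : ℕ → Bool) → edgesMeeting (2 + l) (wheelAdj (2 + l)) α
  ≡ count< (suc l) (λ i → α 0 ∨ α (suc i))
    + sum< (suc l) (λ i → count< i (λ u → wheelAdj (2 + l) (suc u) (suc i) ∧ (α (suc u) ∨ α (suc i))))
edgesMeeting-wheel l α = trans (countPairs<-columns (2 + l) (λ a b → wheelAdj (2 + l) a b ∧ (α a ∨ α b)))
  (sum<-+ (suc l) (λ i → bool→ℕ (α 0 ∨ α (suc i)))
                  (λ i → count< i (λ u → wheelAdj (2 + l) (suc u) (suc i) ∧ (α (suc u) ∨ α (suc i)))))

-- Below the rim vertex j + 1 only its predecessor j is adjacent, and vertex 1 when j + 1
-- is the last rim vertex.
wheel-column≤ : ∀ l (α : ℕ → Bool) j →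
  count< (suc j) (λ u → wheelAdj (2 + l) (suc u) (2 + j) ∧ (α (suc u) ∨ α (2 + j)))
  ≤ bool→ℕ (α (suc j) ∨ α (2 + j)) + bool→ℕ ((suc j ≡ᵇ l) ∧ (α 1 ∨ α (2 + j)))
wheel-column≤ l α j = begin
    count< (suc j) (λ u → wheelAdj (2 + l) (suc u) (2 + j) ∧ X u)
  ≤⟨ sum<-mono (suc j) (λ u u<1+j → adjacentCases (u ≡ᵇ j) _ ((u ≡ᵇ 0) ∧ (suc j ≡ᵇ l)) (X u)
       (≢⇒≡ᵇ≡false (2 + j) u (≢-sym (<⇒≢ (m<n⇒m<1+n u<1+j))))) ⟩
    sum< (suc j) (λ u → bool→ℕ ((u ≡ᵇ j) ∧ X u) + bool→ℕ (((u ≡ᵇ 0) ∧ (suc j ≡ᵇ l)) ∧ X u))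
  ≡⟨ sum<-+ (suc j) (λ u → bool→ℕ ((u ≡ᵇ j) ∧ X u)) (λ u → bool→ℕ (((u ≡ᵇ 0) ∧ (suc j ≡ᵇ l)) ∧ X u)) ⟩
    count< (suc j) (λ u → (u ≡ᵇ j) ∧ X u) + (bool→ℕ ((suc j ≡ᵇ l) ∧ X 0) + count< j (λ _ → false))
  ≤⟨ +-mono-≤ (count<-≡ᵇ (suc j) j X) (≤-reflexive (trans (cong (_+_ _) (count<-false j)) (+-identityʳ _))) ⟩
    bool→ℕ (X j) + bool→ℕ ((suc j ≡ᵇ l) ∧ X 0) ∎
  where
  open ≤-Reasoning
  X : ℕ → Bool
  X u = α (suc u) ∨ α (2 + j)
  adjacentCases : ∀ a b c x → b ≡ false →
    bool→ℕ ((a ∨ (b ∨ (c ∨ false))) ∧ x) ≤ bool→ℕ (a ∧ x) + bool→ℕ (c ∧ x)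
  adjacentCases true  .false c     true  refl = s≤s z≤n
  adjacentCases true  .false c     false refl = z≤n
  adjacentCases false .false true  x     refl = ≤-refl
  adjacentCases false .false false x     refl = z≤n

wheel-rim≤ : ∀ l (α : ℕ → Bool) →
  sum< (suc l) (λ i → count< i (λ u → wheelAdj (2 + l) (suc u) (suc i) ∧ (α (suc u) ∨ α (suc i))))
  ≤ cycleSum l (λ i j → bool→ℕ (α (suc i) ∨ α (suc j)))
wheel-rim≤ l α = begin
    sum< l (λ j → count< (suc j) (λ u → wheelAdj (2 + l) (suc u) (2 + j) ∧ (α (suc u) ∨ α (2 + j))))
  ≤⟨ sum<-mono l (λ j _ → wheel-column≤ l α j) ⟩
    sum< l (λ j → bool→ℕ (α (suc j) ∨ α (2 + j)) + bool→ℕ ((suc j ≡ᵇ l) ∧ (α 1 ∨ α (2 + j))))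
  ≡⟨ sum<-+ l (λ j → bool→ℕ (α (suc j) ∨ α (2 + j))) (λ j → bool→ℕ ((suc j ≡ᵇ l) ∧ (α 1 ∨ α (2 + j)))) ⟩
    sum< l (λ j → bool→ℕ (α (suc j) ∨ α (2 + j))) + count< l (λ j → (suc j ≡ᵇ l) ∧ (α 1 ∨ α (2 + j)))
  ≤⟨ +-monoʳ-≤ (sum< l (λ j → bool→ℕ (α (suc j) ∨ α (2 + j)))) (closingEdge l) ⟩
    sum< l (λ j → bool→ℕ (α (suc j) ∨ α (2 + j))) + bool→ℕ (α 1 ∨ α (suc l))
  ≡⟨ cong (λ b → sum< l (λ j → bool→ℕ (α (suc j) ∨ α (2 + j))) + bool→ℕ b) (∨-comm (α 1) (α (suc l))) ⟩
    cycleSum l (λ i j → bool→ℕ (α (suc i) ∨ α (suc j))) ∎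
  where
  open ≤-Reasoning
  closingEdge : ∀ l → count< l (λ j → (suc j ≡ᵇ l) ∧ (α 1 ∨ α (2 + j))) ≤ bool→ℕ (α 1 ∨ α (suc l))
  closingEdge zero    = z≤n
  closingEdge (suc l) = count<-≡ᵇ (suc l) l (λ j → α 1 ∨ α (2 + j))

c+2≤m+a : ∀ {c a m} → 3 ≤ m → c ≤ a + a → c ≤ m → c + 2 ≤ m + a
c+2≤m+a {c} {zero}        3≤m c≤0 _ =
  ≤-trans (+-monoˡ-≤ 2 c≤0) (≤-trans (≤-trans (n≤1+n 2) 3≤m) (m≤m+n _ 0))
c+2≤m+a {c} {suc zero}    3≤m c≤2 _ =
  ≤-trans (+-monoˡ-≤ 2 c≤2) (subst (4 ≤_) (+-comm 1 _) (s≤s 3≤m))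
c+2≤m+a {c} {suc (suc a)} _ _ c≤m = +-mono-≤ c≤m (s≤s (s≤s z≤n))

wheel-upper : ∀ l → 2 ≤ l → ∀ (α : ℕ → Bool) →
  count< (2 + l) (λ i → not (α i)) + edgesMeeting (2 + l) (wheelAdj (2 + l)) α + 3 ≤ 2 * (2 + l) + count< (2 + l) α
wheel-upper l 2≤l α = begin
    (bool→ℕ (not (α 0)) + k) + edgesMeeting (2 + l) (wheelAdj (2 + l)) α + 3
  ≤⟨ +-monoˡ-≤ 3 (+-monoʳ-≤ (bool→ℕ (not (α 0)) + k) spokesAndRim) ⟩
    (bool→ℕ (not (α 0)) + k) + (count< (suc l) (λ i → α 0 ∨ α (suc i)) + rim) + 3
  ≤⟨ byHub (α 0) ⟩
    2 * (2 + l) + (bool→ℕ (α 0) + a) ∎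
  where
  open ≤-Reasoning
  α′ : ℕ → Bool
  α′ i = α (suc i)
  k = count< (suc l) (λ i → not (α′ i))
  a = count< (suc l) α′
  rim = cycleSum l (λ i j → bool→ℕ (α′ i ∨ α′ j))
  spokesAndRim : edgesMeeting (2 + l) (wheelAdj (2 + l)) α ≤ count< (suc l) (λ i → α 0 ∨ α (suc i)) + rim
  spokesAndRim = ≤-trans (≤-reflexive (edgesMeeting-wheel l α))
                         (+-monoʳ-≤ (count< (suc l) (λ i → α 0 ∨ α (suc i))) (wheel-rim≤ l α))
  byHub : ∀ b → (bool→ℕ (not b) + k) + (count< (suc l) (λ i → b ∨ α′ i) + rim) + 3
              ≤ 2 * (2 + l) + (bool→ℕ b + a)
  byHub true = begin
      k + (count< (suc l) (λ _ → true) + rim) + 3 ≡⟨ cong (λ s → k + (s + rim) + 3) (count<-true (suc l)) ⟩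
      k + (suc l + rim) + 3                       ≡⟨ reorder k rim l ⟩
      (rim + k) + (l + 4)                         ≤⟨ +-monoˡ-≤ (l + 4) (cycleSum-∨+count-not≤ l α′) ⟩
      (suc l + a) + (l + 4)                       ≡⟨ reorder′ l a ⟩
      2 * (2 + l) + (1 + a)                       ∎
    where
    reorder : ∀ k c l → k + (suc l + c) + 3 ≡ (c + k) + (l + 4)
    reorder = solve-∀
    reorder′ : ∀ l a → (suc l + a) + (l + 4) ≡ 2 * (2 + l) + (1 + a)
    reorder′ = solve-∀
  byHub false = begin
      (1 + k) + (a + rim) + 3   ≡⟨ reorder k a rim ⟩
      (a + k) + (rim + 2) + 2   ≤⟨ +-monoˡ-≤ 2 (+-mono-≤ (≤-reflexive (count<-+-count<-not (suc l) α′))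
                                     (c+2≤m+a (s≤s 2≤l) (cycleSum-∨≤count+count l α′) (cycleSum-∨≤length l α′))) ⟩
      suc l + (suc l + a) + 2   ≡⟨ reorder′ l a ⟩
      2 * (2 + l) + (0 + a)     ∎
    where
    reorder : ∀ k a c → (1 + k) + (a + c) + 3 ≡ (a + k) + (c + 2) + 2
    reorder = solve-∀
    reorder′ : ∀ l a → suc l + (suc l + a) + 2 ≡ 2 * (2 + l) + (0 + a)
    reorder′ = solve-∀

∂-R-W : ∀ l → 2 ≤ l → ∂Is (R (W (2 + l))) (+ (2 * (2 + l)) - + 3)
∂-R-W l 2≤l = ∂Is-R (W n) (wheelAdj n) (λ _ _ → refl) (2 * n) 3 (wheel-upper l 2≤l) hub Fin.zero _ lower
  where
  n = 2 + l
  hub : ℕ → Bool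
  hub j = j ≡ᵇ 0
  spokes≤ : suc l ≤ edgesMeeting n (wheelAdj n) hub
  spokes≤ = ≤-trans (≤-reflexive (sym (count<-true (suc l))))
                    (≤-trans (m≤m+n _ _) (≤-reflexive (sym (edgesMeeting-wheel l hub))))
  lower : 2 * n + count< n hub ≤ count< n (λ j → not (hub j) ∧ wheelAdj n 0 j) + edgesMeeting n (wheelAdj n) hub + 3
  lower = begin
      2 * n + (1 + count< (suc l) (λ _ → false))
    ≡⟨ cong (λ c → 2 * n + (1 + c)) (count<-false (suc l)) ⟩
      2 * n + 1
    ≡⟨ reorder l ⟩
      suc l + suc l + 3
    ≤⟨ +-monoˡ-≤ 3 (+-mono-≤ (≤-reflexive (sym (count<-true (suc l)))) spokes≤) ⟩
      count< (suc l) (λ _ → true) + edgesMeeting n (wheelAdj n) hub + 3 ∎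
    where
    open ≤-Reasoning
    reorder : ∀ l → 2 * (2 + l) + 1 ≡ suc l + suc l + 3
    reorder = solve-∀

proposition2p11 : (p q n : ℕ) → 1 ≤ p → 1 ≤ q → p + q ≡ n → 4 ≤ n → p ≤ q →
    ∂Is (R (K n)) ((+ ((n * (n ∸ 1)) / 2) - (+ n)) ⊕ (+ 3))
    × ∂Is (R (W n)) ((+ (2 * n)) - (+ 3))
    × ∂Is (R (Kbip p q)) ((+ (q * (p + 1))) - (+ p))
proposition2p11 p q .(4 + j) 1≤p _ p+q≡n (s≤s (s≤s (s≤s (s≤s {n = j} z≤n)))) p≤q =
  subst (∂Is (R (K n))) completeValue (∂-R-K (suc j)) ,
  ∂-R-W (2 + j) (s≤s (s≤s z≤n)) ,
  ∂-R-Kbip p q 1≤p p≤q (subst (4 ≤_) (sym p+q≡n) (s≤s (s≤s (s≤s (s≤s z≤n)))))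
  where
  n = 4 + j
  shift : ∀ (x y z : ℤ) → (x ⊕ z) - y ≡ (x - y) ⊕ z
  shift = ℤ-Solver.solve-∀
  completeValue : + (choose2 n + 3) - + n ≡ (+ (n * (n ∸ 1) / 2) - + n) ⊕ + 3
  completeValue = begin
      + (choose2 n + 3) - + n           ≡⟨ cong (_- + n) (pos-+ (choose2 n) 3) ⟩
      (+ choose2 n ⊕ + 3) - + n         ≡⟨ shift (+ choose2 n) (+ n) (+ 3) ⟩
      (+ choose2 n - + n) ⊕ + 3         ≡⟨ cong (λ c → (+ c - + n) ⊕ + 3) (n*[n∸1]/2≡choose2 n) ⟨
      (+ (n * (n ∸ 1) / 2) - + n) ⊕ + 3 ∎
    where open ≡-Reasoning
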